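{- Let $k\ge1$, $n=2k+1$, and let $c$ be the lexical edge coloring of $M_k$ (and of $M_k/\pi$) described in the context. Then: (1) in $M_k/\pi$, every vertex is incident to exactly one edge of each color $0,1,\dots,k$, so the color classes form a $1$-factorization of $M_k/\pi$; (2) likewise, in $M_k$ every vertex is incident to exactly one edge of each color, so the coloring is a (covering) $1$-factorization of $M_k$; (3) the coloring is compatible with $\aleph$: for every $A\in L_k$ and every $i\notin A$, the edge $\{\aleph(A\cup\{i\}),\aleph(A)\}=\{\aleph(A\cup\{i\}),\aleph(A\cup\{i\})\cup\{n-1-i\}\}$ receives the same color as the edge $\{A,A\cup\{i\}\}$; in particular both edges of every skew specular pair of $M_k/\pi$ have the same color, so the $1$-factorization of $M_k/\pi$ collapses to a well-defined edge coloring (quotient $1$-factorization) of the reduced graph $R_k$.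
   Context: Let $k\ge1$, $n=2k+1$, indices taken mod $n$. Vertices of the $n$-cube are subsets $A\subseteq\{0,\dots,n-1\}$, identified with binary strings $b_0\dots b_{n-1}$; $L_j$ is the set of $j$-subsets. $M_k$ is the bipartite graph on $L_k\cup L_{k+1}$ with $A\sim A'$ iff $A\subset A'$. $\pi$ identifies sets that are cyclic translates of each other mod $n$; $M_k/\pi$ is the quotient multigraph whose edges are the translation orbits of edges of $M_k$. $\aleph(b_0\dots b_{n-1})=\bar b_{n-1}\dots\bar b_0$ (complement and reverse), a bijection $L_k\to L_{k+1}$ whose inverse is given by the same formula; it induces $\aleph_\pi:L_k/\pi\to L_{k+1}/\pi$. An edge of $M_k/\pi$ joining $u\in L_k/\pi$ and $w\in L_{k+1}/\pi$ is skew if $w\neq\aleph_\pi(u)$; a skew specular pair is a pair consisting of an edge $\{A,A\cup\{i\}\}$ (up to translation) and the edge $\{\aleph(A\cup\{i\}),\aleph(A)\}$ (up to translation). The reduced graph $R_k$ has vertex set $L_k/\pi$ (each $u$ standing for the pair $(u,\aleph_\pi(u))$), one edge per skew specular pair, and one loop at $u$ per horizontal edge between $u$ and $\aleph_\pi(u)$. Lexical coloring: for $A\in L_k$ and $i\notin A$, let $b_t=1$ iff $t+i\in A$ (so $b_0=0$ and $b_1\dots b_{2k}$ has $k$ ones and $k$ zeros). Read $b_1,\dots,b_{2k}$ as a lattice path from $(0,0)$ to $(k,k)$, a $0$ being a step $(1,0)$ and a $1$ a step $(0,1)$. The color of the edge $\{A,A\cup\{i\}\}$ is the number of steps $(x,y)\to(x+1,y)$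 of this path with $y\le x$ (horizontal steps below the diagonal); it lies in $\{0,\dots,k\}$ and is invariant under translation, hence also colors the edges of $M_k/\pi$. -}

module Defs where

open import Data.Nat using (ℕ; zero; suc; _+_; _≤ᵇ_)
open import Data.Nat.DivMod using (_mod_)
open import Data.Bool using (Bool; true; false; if_then_else_; not)
open import Data.Fin using (Fin; toℕ; opposite)
open import Data.Fin.Subset using (Subset)
open import Data.Vec using (lookup; tabulate)
open import Data.List using (List; []; _∷_; map; upTo)
open import Data.Product using (Σ; ∃; _×_; _,_)
open import Relation.Binary.PropositionalEquality using (_≡_)

N : ℕ → ℕ
N k = suc (k + k)

addMod : ∀ k → Fin (N k) → Fin (N k) → Fin (N k)
addMod k a b = (toℕ a + toℕ b) mod (N k)

-- translate A by -t :  s ∈ shift t A  iff  s + t ∈ A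
shift : ∀ k → Fin (N k) → Subset (N k) → Subset (N k)
shift k t A = tabulate (λ s → lookup A (addMod k s t))

aleph : ∀ k → Subset (N k) → Subset (N k)
aleph k A = tabulate (λ j → not (lookup A (opposite j)))

-- number of horizontal steps (x,y) → (x+1,y) with y ≤ x, path starting at (x,y)
hsteps : ℕ → ℕ → List Bool → ℕ
hsteps x y []            = 0
hsteps x y (false ∷ bs)  = (if y ≤ᵇ x then 1 else 0) + hsteps (suc x) y bs
hsteps x y (true  ∷ bs)  = hsteps x (suc y) bs

lexWord : ∀ k → Subset (N k) → Fin (N k) → List Bool
lexWord k A i = map (λ t → lookup A ((suc t + toℕ i) mod (N k))) (upTo (k + k))

-- lexical color of the edge {A, A ∪ {i}}
color : ∀ k → Subset (N k) → Fin (N k) → ℕ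
color k A i = hsteps 0 0 (lexWord k A i)

transl : ∀ k → Subset (N k) → Subset (N k) → Set
transl k A B = ∃ λ t → B ≡ shift k t A

-- translation equivalence of edges {A, A ∪ {i}} encoded as pairs (A , i)
translE : ∀ k → (Subset (N k) × Fin (N k)) → (Subset (N k) × Fin (N k)) → Set
translE k (A , i) (B , j) = ∃ λ t → B ≡ shift k t A × addMod k j t ≡ i

-- The color of the edge {A, A ∪ {i}} is the number of horizontal steps
-- below the diagonal of the lattice path b₁ … b_{2k} read cyclically from i.
-- (a) Lattice paths: the two rotations u0v and v0u of a balanced path around a
--     horizontal step have different counts (rotation-≢), and reflecting a
--     balanced path in the antidiagonal (complement-and-reverse) preserves the
--     count (hsteps-ℵʷ-balanced).
-- (b) For a k-set A, the words at the k + 1 positions i ∉ A are such rotations,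
--     so the colors of the k + 1 edges above A are distinct values in {0, …, k};
--     a pigeonhole argument on subsets makes each color appear once
--     (lower-vertex).  The word of the edge ℵ(A, i) is the reflected word, which
--     gives part (3) (aleph-compatible); ℵ then transfers (2) from lower to upper
--     vertices (upper-vertex).
-- (c) The color is translation invariant, and translation acts on edges along
--     with their endpoints, which turns uniqueness at a vertex into uniqueness
--     of the edge orbit at its orbit (orbit-unique): part (1).
module Submission where

open import Defs
open import Data.Nat
open import Data.Nat.Properties
open import Data.Nat.DivMod
  using (_%_; _mod_; %-distribˡ-+; m%n%n≡m%n; m%n<n; [m+n]%n≡m%n; m<n⇒m%n≡m; m≤n⇒m%n≡m; m≤n⇒[n∸m]%m≡n%m)
open import Data.Nat.Tactic.RingSolver using (solve-∀)
open import Data.Bool using (Bool; true; false; if_then_else_; not; _∨_)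
open import Data.Bool.Properties using (not-involutive; ∨-zeroʳ; ∨-identityʳ)
open import Data.List using (List; []; _∷_; _++_; [_]; _∷ʳ_; applyUpTo; length)
open import Data.List.Properties using (applyUpTo-∷ʳ; length-applyUpTo; map-upTo)
open import Data.Fin using (Fin; toℕ; fromℕ<; opposite; zero; suc)
open import Data.Fin.Properties
  using (toℕ-fromℕ<; toℕ-injective; toℕ<n; any?; opposite-prop; opposite-involutive)
  renaming (_≟_ to _≟ᶠ_; suc-injective to sucᶠ-injective)
open import Data.Fin.Subset using (Subset; ∣_∣; _∈_; _∉_; _∪_; ⁅_⁆; _-_; ∁; ⊤; inside; outside)
open import Data.Fin.Subset.Properties
  using (x∈p∧x≢y⇒x∈p-y; x∈p⇒∣p-x∣<∣p∣; _∈?_; ∈⊤; ∣⊤∣≡n; ∣∁p∣≡n∸∣p∣; x∈∁p⇒x∉p;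
         x∈⁅x⁆; x≢y⇒x∉⁅y⁆; ∪-identityʳ)
open import Data.Vec using (_∷_; []; lookup; here; there)
open import Data.Vec.Properties
  using (lookup⇒[]=; []=⇒lookup; lookup∘tabulate; tabulate∘lookup; tabulate-cong; lookup-zipWith; lookup-map)
open import Data.Product using (∃; ∃₂; ∃!; _×_; _,_; proj₁; proj₂)
open import Function using (_∘_)
open import Relation.Nullary using (¬_; yes; no; contradiction)
open import Relation.Nullary.Reflects using (ofʸ; ofⁿ)
open import Relation.Nullary.Decidable using (_×-dec_)
open import Relation.Binary.Definitions using (tri<; tri≈; tri>)
open import Relation.Binary.PropositionalEquality
  using (_≡_; _≢_; refl; sym; trans; cong; cong₂; subst; module ≡-Reasoning)


𝟙 : Bool → ℕ
𝟙 b = if b then 1 else 0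

𝟙≤1 : ∀ b → 𝟙 b ≤ 1
𝟙≤1 true  = ≤-refl
𝟙≤1 false = z≤n

≤ᵇ-true : ∀ {a b} → a ≤ b → (a ≤ᵇ b) ≡ true
≤ᵇ-true {a} {b} a≤b with a ≤ᵇ b | ≤ᵇ-reflects-≤ a b
... | true  | _      = refl
... | false | ofⁿ ¬p = contradiction a≤b ¬p

≤ᵇ-false : ∀ {a b} → ¬ a ≤ b → (a ≤ᵇ b) ≡ false
≤ᵇ-false {a} {b} a≰b with a ≤ᵇ b | ≤ᵇ-reflects-≤ a b
... | false | _     = refl
... | true  | ofʸ p = contradiction p a≰b

≤ᵇ-mono : ∀ {a b c d} → (a ≤ b → c ≤ d) → 𝟙 (a ≤ᵇ b) ≤ 𝟙 (c ≤ᵇ d)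
≤ᵇ-mono {a} {b} {c} {d} imp with a ≤ᵇ b | ≤ᵇ-reflects-≤ a b | c ≤ᵇ d | ≤ᵇ-reflects-≤ c d
... | false | _      | _     | _      = z≤n
... | true  | _      | true  | _      = ≤-refl
... | true  | ofʸ p  | false | ofⁿ ¬q = contradiction (imp p) ¬q

≤ᵇ-cong : ∀ {a b c d} → (a ≤ b → c ≤ d) → (c ≤ d → a ≤ b) → (a ≤ᵇ b) ≡ (c ≤ᵇ d)
≤ᵇ-cong {a} {b} {c} {d} f g with a ≤ᵇ b | ≤ᵇ-reflects-≤ a b | c ≤ᵇ d | ≤ᵇ-reflects-≤ c d
... | true  | _      | true  | _      = refl
... | false | _      | false | _      = refl
... | true  | ofʸ p  | false | ofⁿ ¬q = contradiction (f p) ¬q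
... | false | ofⁿ ¬p | true  | ofʸ q  = contradiction (g q) ¬p

≤ᵇ-suc : ∀ a b → (suc a ≤ᵇ suc b) ≡ (a ≤ᵇ b)
≤ᵇ-suc a b = ≤ᵇ-cong {suc a} {suc b} {a} {b} s≤s⁻¹ s≤s

≤ᵇ-balance : ∀ {p q a b} → p + a ≡ q + b → (p ≤ᵇ q) ≡ (b ≤ᵇ a)
≤ᵇ-balance {p} {q} {a} {b} eq = ≤ᵇ-cong
  (λ p≤q → +-cancelˡ-≤ q b a (≤-trans (≤-reflexive (sym eq)) (+-monoˡ-≤ a p≤q)))
  (λ b≤a → +-cancelʳ-≤ a p q (≤-trans (≤-reflexive eq) (+-monoʳ-≤ q b≤a)))

-- A word b₁…b_m is a lattice path: 0 is a step (1,0), 1 is a step (0,1).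
-- zeros w and ones w are its horizontal and vertical displacements.
zeros : List Bool → ℕ
zeros []          = 0
zeros (false ∷ w) = suc (zeros w)
zeros (true ∷ w)  = zeros w

ones : List Bool → ℕ
ones []          = 0
ones (false ∷ w) = ones w
ones (true ∷ w)  = suc (ones w)

zeros-++ : ∀ u w → zeros (u ++ w) ≡ zeros u + zeros w
zeros-++ []          w = refl
zeros-++ (false ∷ u) w = cong suc (zeros-++ u w)
zeros-++ (true ∷ u)  w = zeros-++ u w

ones-++ : ∀ u w → ones (u ++ w) ≡ ones u + ones w
ones-++ []          w = refl
ones-++ (false ∷ u) w = ones-++ u w
ones-++ (true ∷ u)  w = cong suc (ones-++ u w)

zeros+ones : ∀ w → zeros w + ones w ≡ length w
zeros+ones []          = refl
zeros+ones (false ∷ w) = cong suc (zeros+ones w)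
zeros+ones (true ∷ w)  = trans (+-suc (zeros w) (ones w)) (cong suc (zeros+ones w))

hsteps-diagonal : ∀ c x y w → hsteps (c + x) (c + y) w ≡ hsteps x y w
hsteps-diagonal c x y []          = refl
hsteps-diagonal c x y (false ∷ w) =
  cong₂ _+_ (cong 𝟙 (≤ᵇ-cong (+-cancelˡ-≤ c y x) (+-monoʳ-≤ c)))
            (trans (cong (λ z → hsteps z (c + y) w) (sym (+-suc c x))) (hsteps-diagonal c (suc x) y w))
hsteps-diagonal c x y (true ∷ w)  =
  trans (cong (λ z → hsteps (c + x) z w) (sym (+-suc c y))) (hsteps-diagonal c x (suc y) w)

hsteps-on-diagonal : ∀ c w → hsteps c c w ≡ hsteps 0 0 w
hsteps-on-diagonal c w =
  trans (cong (λ z → hsteps z z w) (sym (+-identityʳ c))) (hsteps-diagonal c 0 0 w)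

hsteps-monoˣ : ∀ {x x'} y w → x ≤ x' → hsteps x y w ≤ hsteps x' y w
hsteps-monoˣ y []          _   = z≤n
hsteps-monoˣ y (false ∷ w) x≤x' =
  +-mono-≤ (≤ᵇ-mono {y} {_} {y} (λ y≤x → ≤-trans y≤x x≤x')) (hsteps-monoˣ y w (s≤s x≤x'))
hsteps-monoˣ y (true ∷ w)  x≤x' = hsteps-monoˣ (suc y) w x≤x'

hsteps-antiʸ : ∀ x {y y'} w → y ≤ y' → hsteps x y' w ≤ hsteps x y w
hsteps-antiʸ x []          _    = z≤n
hsteps-antiʸ x (false ∷ w) y≤y' =
  +-mono-≤ (≤ᵇ-mono {_} {x} {_} {x} (≤-trans y≤y')) (hsteps-antiʸ (suc x) w y≤y')
hsteps-antiʸ x (true ∷ w)  y≤y' = hsteps-antiʸ x w (s≤s y≤y')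

hsteps-++ : ∀ x y u w → hsteps x y (u ++ w) ≡ hsteps x y u + hsteps (x + zeros u) (y + ones u) w
hsteps-++ x y []          w rewrite +-identityʳ x | +-identityʳ y = refl
hsteps-++ x y (false ∷ u) w rewrite hsteps-++ (suc x) y u w | +-suc x (zeros u) =
  sym (+-assoc (𝟙 (y ≤ᵇ x)) (hsteps (suc x) y u) _)
hsteps-++ x y (true ∷ u)  w rewrite hsteps-++ x (suc y) u w | +-suc y (ones u) = refl

hsteps≤zeros : ∀ x y w → hsteps x y w ≤ zeros w
hsteps≤zeros x y []          = z≤n
hsteps≤zeros x y (false ∷ w) = +-mono-≤ (𝟙≤1 (y ≤ᵇ x)) (hsteps≤zeros (suc x) y w)
hsteps≤zeros x y (true ∷ w)  = hsteps≤zeros x (suc y) w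

hsteps-after-false : ∀ u v → hsteps 0 0 (u ++ false ∷ v) ≡
  hsteps 0 0 u + (𝟙 (ones u ≤ᵇ zeros u) + hsteps (suc (zeros u)) (ones u) v)
hsteps-after-false u v = hsteps-++ 0 0 u (false ∷ v)

-- In u0v the middle
-- step counts and v starts weakly below the diagonal, so it contributes at
-- least hsteps 0 0 v; in v0u the prefix v ends strictly above the diagonal, so
-- the middle step does not count and u contributes at most hsteps 0 0 u.
rotation-< : ∀ u v {k} → zeros u + suc (zeros v) ≡ k → ones u + ones v ≡ k → ones u ≤ zeros u →
  hsteps 0 0 (v ++ false ∷ u) < hsteps 0 0 (u ++ false ∷ v)
rotation-< u v {k} zeros≡k ones≡k u-below = begin-strict
    hsteps 0 0 (v ++ false ∷ u)
      ≡⟨ hsteps-after-false v u ⟩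
    hsteps 0 0 v + (𝟙 (ones v ≤ᵇ zeros v) + hsteps (suc (zeros v)) (ones v) u)
      ≡⟨ cong (λ b → hsteps 0 0 v + (𝟙 b + hsteps (suc (zeros v)) (ones v) u)) v-above ⟩
    hsteps 0 0 v + hsteps (suc (zeros v)) (ones v) u
      ≤⟨ +-monoʳ-≤ (hsteps 0 0 v) (hsteps-antiʸ (suc (zeros v)) u v-strictly-above) ⟩
    hsteps 0 0 v + hsteps (suc (zeros v)) (suc (zeros v)) u
      ≡⟨ cong (hsteps 0 0 v +_) (hsteps-on-diagonal (suc (zeros v)) u) ⟩
    hsteps 0 0 v + hsteps 0 0 u
      <⟨ n<1+n _ ⟩
    suc (hsteps 0 0 v + hsteps 0 0 u)
      ≡⟨ cong suc (+-comm (hsteps 0 0 v) (hsteps 0 0 u)) ⟩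
    suc (hsteps 0 0 u + hsteps 0 0 v)
      ≡⟨ cong (λ h → suc (hsteps 0 0 u + h)) (hsteps-on-diagonal (ones u) v) ⟨
    suc (hsteps 0 0 u + hsteps (ones u) (ones u) v)
      ≤⟨ s≤s (+-monoʳ-≤ (hsteps 0 0 u) (hsteps-monoˣ (ones u) v (m≤n⇒m≤1+n u-below))) ⟩
    suc (hsteps 0 0 u + hsteps (suc (zeros u)) (ones u) v)
      ≡⟨ +-suc (hsteps 0 0 u) _ ⟨
    hsteps 0 0 u + (1 + hsteps (suc (zeros u)) (ones u) v)
      ≡⟨ cong (λ b → hsteps 0 0 u + (𝟙 b + hsteps (suc (zeros u)) (ones u) v)) u-on ⟨
    hsteps 0 0 u + (𝟙 (ones u ≤ᵇ zeros u) + hsteps (suc (zeros u)) (ones u) v)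
      ≡⟨ hsteps-after-false u v ⟨
    hsteps 0 0 (u ++ false ∷ v) ∎
  where
    open ≤-Reasoning
    v-strictly-above : suc (zeros v) ≤ ones v
    v-strictly-above = +-cancelˡ-≤ (zeros u) _ _ (begin
       zeros u + suc (zeros v) ≡⟨ trans zeros≡k (sym ones≡k) ⟩
       ones u + ones v         ≤⟨ +-monoˡ-≤ (ones v) u-below ⟩
       zeros u + ones v        ∎)
    v-above : (ones v ≤ᵇ zeros v) ≡ false
    v-above = ≤ᵇ-false (<⇒≱ v-strictly-above)
    u-on : (ones u ≤ᵇ zeros u) ≡ true
    u-on = ≤ᵇ-true u-below

-- Hence the two rotations of a balanced path around a horizontal step never
-- have the same lexical count (apply rotation-< to whichever of u, v ends
-- below the diagonal).
rotation-≢ : ∀ u v {k} → zeros u + suc (zeros v) ≡ k → ones u + ones v ≡ k →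
  hsteps 0 0 (u ++ false ∷ v) ≢ hsteps 0 0 (v ++ false ∷ u)
rotation-≢ u v {k} zeros≡k ones≡k eq with ones u ≤? zeros u
... | yes u-below = <-irrefl (sym eq) (rotation-< u v zeros≡k ones≡k u-below)
... | no  u-above = <-irrefl eq (rotation-< v u zeros≡k′ ones≡k′ v-below)
  where
    zeros≡k′ : zeros v + suc (zeros u) ≡ k
    zeros≡k′ = trans (swap-suc (zeros v) (zeros u)) zeros≡k
      where swap-suc : ∀ a b → a + suc b ≡ b + suc a
            swap-suc = solve-∀
    ones≡k′ : ones v + ones u ≡ k
    ones≡k′ = trans (+-comm (ones v) (ones u)) ones≡k
    v-below : ones v ≤ zeros v
    v-below = +-cancelˡ-≤ (ones u) _ _ (begin
        ones u + ones v           ≡⟨ trans ones≡k (sym zeros≡k) ⟩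
        zeros u + suc (zeros v)   ≡⟨ +-suc (zeros u) (zeros v) ⟩
        suc (zeros u) + zeros v   ≤⟨ +-monoˡ-≤ (zeros v) (≰⇒> u-above) ⟩
        ones u + zeros v          ∎)
      where open ≤-Reasoning

-- Complement-and-reverse on words: the path reflected in the antidiagonal.
ℵʷ : List Bool → List Bool
ℵʷ []      = []
ℵʷ (b ∷ w) = ℵʷ w ++ [ not b ]

zeros-ℵʷ : ∀ w → zeros (ℵʷ w) ≡ ones w
zeros-ℵʷ []          = refl
zeros-ℵʷ (false ∷ w) = trans (zeros-++ (ℵʷ w) _) (trans (+-identityʳ _) (zeros-ℵʷ w))
zeros-ℵʷ (true ∷ w)  = trans (zeros-++ (ℵʷ w) _) (trans (+-comm (zeros (ℵʷ w)) 1) (cong suc (zeros-ℵʷ w)))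

ones-ℵʷ : ∀ w → ones (ℵʷ w) ≡ zeros w
ones-ℵʷ []          = refl
ones-ℵʷ (false ∷ w) = trans (ones-++ (ℵʷ w) _) (trans (+-comm (ones (ℵʷ w)) 1) (cong suc (ones-ℵʷ w)))
ones-ℵʷ (true ∷ w)  = trans (ones-++ (ℵʷ w) _) (trans (+-identityʳ _) (ones-ℵʷ w))

vsteps : ℕ → ℕ → List Bool → ℕ
vsteps x y []          = 0
vsteps x y (false ∷ w) = vsteps (suc x) y w
vsteps x y (true ∷ w)  = 𝟙 (suc y ≤ᵇ x) + vsteps x (suc y) w

excess-right : ∀ x y → 𝟙 (y ≤ᵇ x) + (x ∸ y) ≡ suc x ∸ y
excess-right x       zero    = refl
excess-right zero    (suc y) = sym (0∸n≡0 y)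
excess-right (suc x) (suc y) = trans (cong (λ b → 𝟙 b + (x ∸ y)) (≤ᵇ-suc y x)) (excess-right x y)

excess-up : ∀ x y → x ∸ y ≡ 𝟙 (suc y ≤ᵇ x) + (x ∸ suc y)
excess-up zero    y       = 0∸n≡0 y
excess-up (suc x) zero    = refl
excess-up (suc x) (suc y) = trans (excess-up x y) (cong (λ b → 𝟙 b + (x ∸ suc y)) (sym (≤ᵇ-suc (suc y) x)))

hsteps-vsteps : ∀ x y w →
  hsteps x y w + (x ∸ y) ≡ vsteps x y w + ((x + zeros w) ∸ (y + ones w))
hsteps-vsteps x y [] rewrite +-identityʳ x | +-identityʳ y = refl
hsteps-vsteps x y (false ∷ w) = begin
    (𝟙 (y ≤ᵇ x) + hsteps (suc x) y w) + (x ∸ y)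
      ≡⟨ +-rearrange (𝟙 (y ≤ᵇ x)) (hsteps (suc x) y w) (x ∸ y) ⟩
    hsteps (suc x) y w + (𝟙 (y ≤ᵇ x) + (x ∸ y))
      ≡⟨ cong (hsteps (suc x) y w +_) (excess-right x y) ⟩
    hsteps (suc x) y w + (suc x ∸ y)
      ≡⟨ hsteps-vsteps (suc x) y w ⟩
    vsteps (suc x) y w + ((suc x + zeros w) ∸ (y + ones w))
      ≡⟨ cong (λ z → vsteps (suc x) y w + (z ∸ (y + ones w))) (+-suc x (zeros w)) ⟨
    vsteps (suc x) y w + ((x + suc (zeros w)) ∸ (y + ones w)) ∎
  where
    open ≡-Reasoning
    +-rearrange : ∀ a b c → (a + b) + c ≡ b + (a + c)
    +-rearrange = solve-∀
hsteps-vsteps x y (true ∷ w) = begin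
    hsteps x (suc y) w + (x ∸ y)
      ≡⟨ cong (hsteps x (suc y) w +_) (excess-up x y) ⟩
    hsteps x (suc y) w + (𝟙 (suc y ≤ᵇ x) + (x ∸ suc y))
      ≡⟨ +-rearrange′ (hsteps x (suc y) w) (𝟙 (suc y ≤ᵇ x)) (x ∸ suc y) ⟩
    𝟙 (suc y ≤ᵇ x) + (hsteps x (suc y) w + (x ∸ suc y))
      ≡⟨ cong (𝟙 (suc y ≤ᵇ x) +_) (hsteps-vsteps x (suc y) w) ⟩
    𝟙 (suc y ≤ᵇ x) + (vsteps x (suc y) w + ((x + zeros w) ∸ (suc y + ones w)))
      ≡⟨ +-assoc (𝟙 (suc y ≤ᵇ x)) _ _ ⟨
    vsteps x y (true ∷ w) + ((x + zeros w) ∸ (suc y + ones w))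
      ≡⟨ cong (λ z → vsteps x y (true ∷ w) + ((x + zeros w) ∸ z)) (+-suc y (ones w)) ⟨
    vsteps x y (true ∷ w) + ((x + zeros w) ∸ (y + suc (ones w))) ∎
  where
    open ≡-Reasoning
    +-rearrange′ : ∀ a b c → a + (b + c) ≡ b + (a + c)
    +-rearrange′ = solve-∀

-- The hypothesis X + (y + ones w) = Y + (x + zeros w) says that ℵʷ w started at
-- (X,Y) is the image of w started at (x,y) under a reflection in an antidiagonal
-- that preserves the offset a − b.  The reflection exchanges horizontal and
-- vertical steps, and horizontal steps of ℵʷ w weakly below the diagonal are
-- exactly the images of vertical steps of w strictly below it.
hsteps-ℵʷ : ∀ X Y x y w → X + y + ones w ≡ Y + x + zeros w → hsteps X Y (ℵʷ w) ≡ vsteps x y w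
hsteps-ℵʷ X Y x y [] _ = refl
hsteps-ℵʷ X Y x y (false ∷ w) reflected = begin
    hsteps X Y (ℵʷ w ++ [ true ])   ≡⟨ hsteps-++ X Y (ℵʷ w) _ ⟩
    hsteps X Y (ℵʷ w) + 0           ≡⟨ +-identityʳ _ ⟩
    hsteps X Y (ℵʷ w)               ≡⟨ hsteps-ℵʷ X Y (suc x) y w (trans reflected (shuffle Y x (zeros w))) ⟩
    vsteps (suc x) y w ∎
  where
    open ≡-Reasoning
    shuffle : ∀ a b c → a + b + suc c ≡ a + suc b + c
    shuffle = solve-∀
hsteps-ℵʷ X Y x y (true ∷ w) reflected = begin
    hsteps X Y (ℵʷ w ++ [ false ])
      ≡⟨ hsteps-++ X Y (ℵʷ w) _ ⟩
    hsteps X Y (ℵʷ w) + (𝟙 (Y + ones (ℵʷ w) ≤ᵇ X + zeros (ℵʷ w)) + 0)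
      ≡⟨ cong (λ h → hsteps X Y (ℵʷ w) + h) (+-identityʳ _) ⟩
    hsteps X Y (ℵʷ w) + 𝟙 (Y + ones (ℵʷ w) ≤ᵇ X + zeros (ℵʷ w))
      ≡⟨ +-comm (hsteps X Y (ℵʷ w)) _ ⟩
    𝟙 (Y + ones (ℵʷ w) ≤ᵇ X + zeros (ℵʷ w)) + hsteps X Y (ℵʷ w)
      ≡⟨ cong₂ (λ b h → 𝟙 b + h) last-step-below (hsteps-ℵʷ X Y x (suc y) w reflected′) ⟩
    𝟙 (suc y ≤ᵇ x) + vsteps x (suc y) w ∎
  where
    open ≡-Reasoning
    shuffle : ∀ a b c → a + b + suc c ≡ a + suc b + c
    shuffle = solve-∀
    reflected′ : X + suc y + ones w ≡ Y + x + zeros w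
    reflected′ = trans (sym (shuffle X y (ones w))) reflected
    last-step-below : (Y + ones (ℵʷ w) ≤ᵇ X + zeros (ℵʷ w)) ≡ (suc y ≤ᵇ x)
    last-step-below = trans (cong₂ (λ o z → Y + o ≤ᵇ X + z) (ones-ℵʷ w) (zeros-ℵʷ w))
      (≤ᵇ-balance {Y + zeros w} {X + ones w} {x} {suc y} (trans (swap Y (zeros w) x) (trans (sym reflected) (swap-suc X y (ones w)))))
      where
        swap : ∀ a b c → a + b + c ≡ a + c + b
        swap = solve-∀
        swap-suc : ∀ a b c → a + b + suc c ≡ a + c + suc b
        swap-suc = solve-∀

hsteps-ℵʷ-balanced : ∀ w → zeros w ≡ ones w → hsteps 0 0 (ℵʷ w) ≡ hsteps 0 0 w
hsteps-ℵʷ-balanced w balanced = begin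
    hsteps 0 0 (ℵʷ w)                  ≡⟨ hsteps-ℵʷ 0 0 0 0 w (sym balanced) ⟩
    vsteps 0 0 w                       ≡⟨ +-identityʳ _ ⟨
    vsteps 0 0 w + 0                   ≡⟨ cong (vsteps 0 0 w +_) no-excess ⟨
    vsteps 0 0 w + (zeros w ∸ ones w)  ≡⟨ hsteps-vsteps 0 0 w ⟨
    hsteps 0 0 w + 0                   ≡⟨ +-identityʳ _ ⟩
    hsteps 0 0 w                       ∎
  where
    open ≡-Reasoning
    no-excess : zeros w ∸ ones w ≡ 0
    no-excess = trans (cong (_∸ ones w) balanced) (n∸n≡0 (ones w))

applyUpTo-cong : ∀ {A : Set} {f g : ℕ → A} L → (∀ t → t < L → f t ≡ g t) → applyUpTo f L ≡ applyUpTo g L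
applyUpTo-cong zero    f≗g = refl
applyUpTo-cong (suc L) f≗g = cong₂ _∷_ (f≗g 0 z<s) (applyUpTo-cong L (λ t t<L → f≗g (suc t) (s<s t<L)))

applyUpTo-split : ∀ {A : Set} (f : ℕ → A) m r →
  applyUpTo f (m + suc r) ≡ applyUpTo f m ++ f m ∷ applyUpTo (λ t → f (suc (m + t))) r
applyUpTo-split f zero    r = refl
applyUpTo-split f (suc m) r = cong (f 0 ∷_) (applyUpTo-split (λ t → f (suc t)) m r)

ones-∷ : ∀ b w → ones (b ∷ w) ≡ 𝟙 b + ones w
ones-∷ true  w = refl
ones-∷ false w = refl

ones-∷ʳ : ∀ w b → ones (w ∷ʳ b) ≡ ones w + 𝟙 b
ones-∷ʳ w b = trans (ones-++ w [ b ]) (cong (ones w +_) (trans (ones-∷ b []) (+-identityʳ (𝟙 b))))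

window-invariant : ∀ (f : ℕ → Bool) L → (∀ p → f (p + L) ≡ f p) →
  ∀ s → ones (applyUpTo (λ t → f (s + t)) L) ≡ ones (applyUpTo f L)
window-invariant f zero    periodic s       = refl
window-invariant f (suc L) periodic zero    = refl
window-invariant f (suc L) periodic (suc s) = begin
    ones (applyUpTo (λ t → f (suc s + t)) (suc L))
      ≡⟨ cong ones (applyUpTo-cong (suc L) (λ t _ → cong f (sym (+-suc s t)))) ⟩
    ones (applyUpTo (λ t → f (s + suc t)) (suc L))
      ≡⟨ cong ones (applyUpTo-∷ʳ (λ t → f (s + suc t)) L) ⟨
    ones (inner ∷ʳ f (s + suc L))
      ≡⟨ ones-∷ʳ inner (f (s + suc L)) ⟩
    ones inner + 𝟙 (f (s + suc L))
      ≡⟨ cong (λ b → ones inner + 𝟙 b) (trans (periodic s) (cong f (sym (+-identityʳ s)))) ⟩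
    ones inner + 𝟙 (f (s + 0))
      ≡⟨ +-comm (ones inner) _ ⟩
    𝟙 (f (s + 0)) + ones inner
      ≡⟨ ones-∷ (f (s + 0)) inner ⟨
    ones (applyUpTo (λ t → f (s + t)) (suc L))
      ≡⟨ window-invariant f (suc L) periodic s ⟩
    ones (applyUpTo f (suc L)) ∎
  where
    open ≡-Reasoning
    inner = applyUpTo (λ t → f (s + suc t)) L

∣∷∣ : ∀ {m} b (A : Subset m) → ∣ b ∷ A ∣ ≡ 𝟙 b + ∣ A ∣
∣∷∣ true  A = refl
∣∷∣ false A = refl

ones-enumeration : ∀ {m} (A : Subset m) (g : ℕ → Bool) → (∀ j → g (toℕ j) ≡ lookup A j) →
  ones (applyUpTo g m) ≡ ∣ A ∣
ones-enumeration []      g g≗A = refl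
ones-enumeration {suc m} (b ∷ A) g g≗A = begin
    ones (g 0 ∷ applyUpTo (λ t → g (suc t)) m)   ≡⟨ ones-∷ (g 0) _ ⟩
    𝟙 (g 0) + ones (applyUpTo (λ t → g (suc t)) m)
      ≡⟨ cong₂ (λ c n → 𝟙 c + n) (g≗A zero) (ones-enumeration A (λ t → g (suc t)) (λ j → g≗A (suc j))) ⟩
    𝟙 b + ∣ A ∣                                  ≡⟨ ∣∷∣ b A ⟨
    ∣ b ∷ A ∣                                    ∎
  where open ≡-Reasoning

∉⇒outside : ∀ {m} (A : Subset m) i → i ∉ A → lookup A i ≡ false
∉⇒outside A i i∉A with lookup A i in eq
... | true  = contradiction (lookup⇒[]= i A eq) i∉A
... | false = refl

outside⇒∉ : ∀ {m} (A : Subset m) i → lookup A i ≡ false → i ∉ A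
outside⇒∉ A i eq i∈A with trans (sym ([]=⇒lookup i∈A)) eq
... | ()

subset-ext : ∀ {m} {u v : Subset m} → (∀ j → lookup u j ≡ lookup v j) → u ≡ v
subset-ext {u = u} {v} u≗v = trans (sym (tabulate∘lookup u)) (trans (tabulate-cong u≗v) (tabulate∘lookup v))

∈-transport : ∀ {m m′} {S : Subset m} {T : Subset m′} {j j′} → lookup S j ≡ lookup T j′ → j ∈ S → j′ ∈ T
∈-transport {T = T} {j′ = j′} eq j∈S = lookup⇒[]= j′ T (trans (sym eq) ([]=⇒lookup j∈S))

lookup-∪-self : ∀ {m} (A : Subset m) x → lookup (A ∪ ⁅ x ⁆) x ≡ true
lookup-∪-self A x = trans (lookup-zipWith _∨_ x A ⁅ x ⁆) (trans (cong (lookup A x ∨_) ([]=⇒lookup (x∈⁅x⁆ x))) (∨-zeroʳ _))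

lookup-∪-other : ∀ {m} (A : Subset m) {x y} → y ≢ x → lookup (A ∪ ⁅ x ⁆) y ≡ lookup A y
lookup-∪-other A {x} {y} y≢x = trans (lookup-zipWith _∨_ y A ⁅ x ⁆)
  (trans (cong (lookup A y ∨_) (∉⇒outside ⁅ x ⁆ y (x≢y⇒x∉⁅y⁆ y≢x))) (∨-identityʳ _))

∣∪⁅⁆∣ : ∀ {m} (X : Subset m) x → x ∉ X → ∣ X ∪ ⁅ x ⁆ ∣ ≡ suc ∣ X ∣
∣∪⁅⁆∣ (outside ∷ X) zero    x∉X = cong suc (cong ∣_∣ (∪-identityʳ X))
∣∪⁅⁆∣ (inside  ∷ X) zero    x∉X = contradiction here x∉X
∣∪⁅⁆∣ (outside ∷ X) (suc x) x∉X = ∣∪⁅⁆∣ X x (x∉X ∘ there)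
∣∪⁅⁆∣ (inside  ∷ X) (suc x) x∉X = cong suc (∣∪⁅⁆∣ X x (x∉X ∘ there))

-- Pigeonhole principle for subsets: a map injective on p that sends p into q
-- shows ∣ p ∣ ≤ ∣ q ∣ (induct on the domain, removing the image of its first
-- element from q).
injection-∣≤∣ : ∀ {n m} (p : Subset n) (q : Subset m) (f : Fin n → Fin m) →
  (∀ {i} → i ∈ p → f i ∈ q) → (∀ {i j} → i ∈ p → j ∈ p → f i ≡ f j → i ≡ j) →
  ∣ p ∣ ≤ ∣ q ∣
injection-∣≤∣ []            q f into inj = z≤n
injection-∣≤∣ (outside ∷ p) q f into inj =
  injection-∣≤∣ p q (f ∘ suc) (into ∘ there) (λ i∈p j∈p eq → sucᶠ-injective (inj (there i∈p) (there j∈p) eq))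
injection-∣≤∣ (inside ∷ p)  q f into inj =
  ≤-trans (s≤s (injection-∣≤∣ p (q - f zero) (f ∘ suc) into-rest inj-rest)) (x∈p⇒∣p-x∣<∣p∣ (into here))
  where
    into-rest : ∀ {i} → i ∈ p → f (suc i) ∈ q - f zero
    into-rest i∈p = x∈p∧x≢y⇒x∈p-y (into (there i∈p)) (λ eq → 0≢1+n (cong toℕ (inj here (there i∈p) (sym eq))))
    inj-rest : ∀ {i j} → i ∈ p → j ∈ p → f (suc i) ≡ f (suc j) → i ≡ j
    inj-rest i∈p j∈p eq = sucᶠ-injective (inj (there i∈p) (there j∈p) eq)

-- Therefore such a map with ∣ q ∣ ≤ ∣ p ∣ hits every element of q: a missed
-- element y would give an injection of p into q − y.
injection-onto : ∀ {n m} (p : Subset n) (q : Subset m) (f : Fin n → Fin m) →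
  (∀ {i} → i ∈ p → f i ∈ q) → (∀ {i j} → i ∈ p → j ∈ p → f i ≡ f j → i ≡ j) →
  ∣ q ∣ ≤ ∣ p ∣ → ∀ {y} → y ∈ q → ∃ λ i → i ∈ p × f i ≡ y
injection-onto p q f into inj ∣q∣≤∣p∣ {y} y∈q with any? (λ i → (i ∈? p) ×-dec (f i ≟ᶠ y))
... | yes hit  = hit
... | no  miss = contradiction (≤-trans ∣q∣≤∣p∣ (injection-∣≤∣ p (q - y) f into-rest inj))
                               (<⇒≱ (x∈p⇒∣p-x∣<∣p∣ y∈q))
  where
    into-rest : ∀ {i} → i ∈ p → f i ∈ q - y
    into-rest i∈p = x∈p∧x≢y⇒x∈p-y (into i∈p) (λ eq → miss (_ , i∈p , eq))

%-absorbˡ : ∀ a b n .{{_ : NonZero n}} → (a % n + b) % n ≡ (a + b) % n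
%-absorbˡ a b n = begin
    (a % n + b) % n          ≡⟨ %-distribˡ-+ (a % n) b n ⟩
    (a % n % n + b % n) % n  ≡⟨ cong (λ z → (z + b % n) % n) (m%n%n≡m%n a n) ⟩
    (a % n + b % n) % n      ≡⟨ %-distribˡ-+ a b n ⟨
    (a + b) % n              ∎
  where open ≡-Reasoning

%-absorbʳ : ∀ a b n .{{_ : NonZero n}} → (a + b % n) % n ≡ (a + b) % n
%-absorbʳ a b n = trans (cong (_% n) (+-comm a (b % n))) (trans (%-absorbˡ b a n) (cong (_% n) (+-comm b a)))

mod-complement : ∀ m a b → a ≤ m → b ≤ m → (a + b) % suc m ≡ m → b ≡ m ∸ a
mod-complement m a b a≤m b≤m sum≡m with a + b ≤? m
... | yes a+b≤m = begin
    b            ≡⟨ m+n∸m≡n a b ⟨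
    a + b ∸ a    ≡⟨ cong (_∸ a) (trans (sym (m≤n⇒m%n≡m a+b≤m)) sum≡m) ⟩
    m ∸ a        ∎
  where open ≡-Reasoning
... | no  a+b≰m = contradiction (+-mono-≤ a≤m b≤m) (<⇒≱ (begin-strict
    m + m                  <⟨ +-monoʳ-< m ≤-refl ⟩
    m + suc m              ≡⟨ cong (_+ suc m) (trans (sym (m≤n⇒m%n≡m wrapped≤m)) (trans (m≤n⇒[n∸m]%m≡n%m (≰⇒> a+b≰m)) sum≡m)) ⟨
    (a + b ∸ suc m) + suc m ≡⟨ m∸n+n≡m (≰⇒> a+b≰m) ⟩
    a + b                  ∎))
  where
    open ≤-Reasoning
    wrapped≤m : a + b ∸ suc m ≤ m
    wrapped≤m = m≤n+o⇒m∸n≤o (a + b) (suc m) (m≤n⇒m≤1+n (+-mono-≤ a≤m b≤m))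

toℕ-mod : ∀ k p → toℕ (p mod N k) ≡ p % N k
toℕ-mod k p = toℕ-fromℕ< _

mod-cong : ∀ k p q → p % N k ≡ q % N k → p mod N k ≡ q mod N k
mod-cong k p q eq = toℕ-injective (trans (toℕ-mod k p) (trans eq (sym (toℕ-mod k q))))

toℕ-mod-id : ∀ k (j : Fin (N k)) → toℕ j mod N k ≡ j
toℕ-mod-id k j = toℕ-injective (trans (toℕ-mod k (toℕ j)) (m<n⇒m%n≡m (toℕ<n j)))

toℕ-mod-injective : ∀ k {a b : Fin (N k)} → toℕ a % N k ≡ toℕ b % N k → a ≡ b
toℕ-mod-injective k {a} {b} eq =
  trans (sym (toℕ-mod-id k a)) (trans (mod-cong k (toℕ a) (toℕ b) eq) (toℕ-mod-id k b))

rotation-moves : ∀ k d x → 0 < d → d < N k → x < N k → (d + x) % N k ≢ x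
rotation-moves k d x 0<d d<N x<N eq with d + x <? N k
... | yes d+x<N = <-irrefl (sym (trans (sym (m<n⇒m%n≡m d+x<N)) eq)) (m<n+m x 0<d)
... | no  d+x≮N = <-irrefl (sym (+-cancelˡ-≡ x _ _ x+N≡x+d)) d<N
  where
    wrapped = d + x ∸ N k
    wrapped<N : wrapped < N k
    wrapped<N = +-cancelʳ-< (N k) wrapped (N k) (begin-strict
      wrapped + N k  ≡⟨ m∸n+n≡m (≮⇒≥ d+x≮N) ⟩
      d + x          <⟨ +-mono-< d<N x<N ⟩
      N k + N k      ∎)
      where open ≤-Reasoning
    wrapped≡x : wrapped ≡ x
    wrapped≡x = trans (sym (m<n⇒m%n≡m wrapped<N)) (trans (m≤n⇒[n∸m]%m≡n%m (≮⇒≥ d+x≮N)) eq)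
    x+N≡x+d : x + N k ≡ x + d
    x+N≡x+d = trans (cong (_+ N k) (sym wrapped≡x)) (trans (m∸n+n≡m (≮⇒≥ d+x≮N)) (+-comm d x))

at : ∀ k → Subset (N k) → ℕ → Bool
at k A p = lookup A (p mod N k)

at-cong : ∀ k A p q → p % N k ≡ q % N k → at k A p ≡ at k A q
at-cong k A p q eq = cong (lookup A) (mod-cong k p q eq)

at-toℕ : ∀ k A (j : Fin (N k)) → at k A (toℕ j) ≡ lookup A j
at-toℕ k A j = cong (lookup A) (toℕ-mod-id k j)

at-periodic : ∀ k A p → at k A (p + N k) ≡ at k A p
at-periodic k A p = at-cong k A (p + N k) p ([m+n]%n≡m%n p (N k))

ones-cyclic-window : ∀ k A s → ones (applyUpTo (λ t → at k A (s + t)) (N k)) ≡ ∣ A ∣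
ones-cyclic-window k A s =
  trans (window-invariant (at k A) (N k) (at-periodic k A) s) (ones-enumeration A (at k A) (at-toℕ k A))

word : ∀ k → Subset (N k) → ℕ → List Bool
word k A x = applyUpTo (λ t → at k A (suc t + x)) (k + k)

color≡hsteps-word : ∀ k A (i : Fin (N k)) → color k A i ≡ hsteps 0 0 (word k A (toℕ i))
color≡hsteps-word k A i = cong (hsteps 0 0) (map-upTo _ (k + k))

-- For x ∉ A the word is a full cyclic window minus the position x itself.
word-ones : ∀ k A x → at k A x ≡ false → ones (word k A x) ≡ ∣ A ∣
word-ones k A x x-outside = begin
    ones (word k A x)                                    ≡⟨ +-identityʳ _ ⟨
    ones (word k A x) + 𝟙 false                          ≡⟨ cong (λ b → ones (word k A x) + 𝟙 b) closing-bit ⟨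
    ones (word k A x) + 𝟙 (at k A (suc (k + k) + x))     ≡⟨ ones-∷ʳ (word k A x) _ ⟨
    ones (word k A x ∷ʳ at k A (suc (k + k) + x))        ≡⟨ cong ones (applyUpTo-∷ʳ _ (k + k)) ⟩
    ones (applyUpTo (λ t → at k A (suc t + x)) (N k))    ≡⟨ cong ones (applyUpTo-cong (N k) (λ t _ → cong (at k A) (shift-suc t))) ⟩
    ones (applyUpTo (λ t → at k A (suc x + t)) (N k))    ≡⟨ ones-cyclic-window k A (suc x) ⟩
    ∣ A ∣                                                ∎
  where
    open ≡-Reasoning
    closing-bit : at k A (suc (k + k) + x) ≡ false
    closing-bit = trans (cong (at k A) (+-comm (N k) x)) (trans (at-periodic k A x) x-outside)
    shift-suc : ∀ t → suc t + x ≡ suc x + t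
    shift-suc t = cong suc (+-comm t x)

word-zeros : ∀ k A x → ∣ A ∣ ≡ k → at k A x ≡ false → zeros (word k A x) ≡ k
word-zeros k A x ∣A∣≡k x-outside = +-cancelʳ-≡ _ _ k (begin
    zeros (word k A x) + k                    ≡⟨ cong (zeros (word k A x) +_) (trans (word-ones k A x x-outside) ∣A∣≡k) ⟨
    zeros (word k A x) + ones (word k A x)    ≡⟨ zeros+ones (word k A x) ⟩
    length (word k A x)                       ≡⟨ length-applyUpTo _ (k + k) ⟩
    k + k                                     ∎)
  where open ≡-Reasoning

word-rotate : ∀ k A x d r → d + suc r ≡ k + k →
  ∃₂ λ u v → word k A x ≡ u ++ at k A (suc (x + d)) ∷ v
           × word k A (suc (x + d)) ≡ v ++ at k A x ∷ u
word-rotate k A x d r d+1+r≡2k = u , v , first , second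
  where
    h : ℕ → Bool
    h t = at k A (suc t + x)
    h′ : ℕ → Bool
    h′ t = at k A (suc t + suc (x + d))
    u = applyUpTo h d
    v = applyUpTo (λ t → h (suc (d + t))) r
    wraps : ∀ p q → q ≡ p + suc (d + suc r) → at k A q ≡ at k A p
    wraps p q q≡p+n = trans (cong (at k A) (trans q≡p+n (cong (λ z → p + suc z) d+1+r≡2k))) (at-periodic k A p)
    first : word k A x ≡ u ++ at k A (suc (x + d)) ∷ v
    first = trans (cong (applyUpTo h) (sym d+1+r≡2k))
           (trans (applyUpTo-split h d r) (cong (λ b → u ++ at k A b ∷ v) (cong suc (+-comm d x))))
    ar₁ : ∀ x d t → suc t + suc (x + d) ≡ suc (suc (d + t)) + x
    ar₁ = solve-∀
    ar₂ : ∀ x d r → suc r + suc (x + d) ≡ x + suc (d + suc r)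
    ar₂ = solve-∀
    ar₃ : ∀ x d r t → suc (suc (r + t)) + suc (x + d) ≡ (suc t + x) + suc (d + suc r)
    ar₃ = solve-∀
    ar₄ : ∀ d r → d + suc r ≡ r + suc d
    ar₄ = solve-∀
    second : word k A (suc (x + d)) ≡ v ++ at k A x ∷ u
    second = trans (cong (applyUpTo h′) (trans (sym d+1+r≡2k) (ar₄ d r)))
            (trans (applyUpTo-split h′ r d)
              (cong₂ _++_ (applyUpTo-cong r (λ t _ → cong (at k A) (ar₁ x d t)))
                (cong₂ _∷_ (wraps x _ (ar₂ x d r)) (applyUpTo-cong d (λ t _ → wraps (suc t + x) _ (ar₃ x d r t))))))

at-outside : ∀ k A i → i ∉ A → at k A (toℕ i) ≡ false
at-outside k A i i∉A = trans (at-toℕ k A i) (∉⇒outside A i i∉A)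

color-≤ : ∀ k A (i : Fin (N k)) → ∣ A ∣ ≡ k → i ∉ A → color k A i ≤ k
color-≤ k A i ∣A∣≡k i∉A = begin
    color k A i                         ≡⟨ color≡hsteps-word k A i ⟩
    hsteps 0 0 (word k A (toℕ i))       ≤⟨ hsteps≤zeros 0 0 (word k A (toℕ i)) ⟩
    zeros (word k A (toℕ i))            ≡⟨ word-zeros k A (toℕ i) ∣A∣≡k (at-outside k A i i∉A) ⟩
    k                                   ∎
  where open ≤-Reasoning

-- Distinct elements outside A receive distinct colors: their words are the two
-- rotations of a balanced path around a horizontal step (rotation-≢).
color-injective-< : ∀ k A (i i′ : Fin (N k)) → ∣ A ∣ ≡ k → i ∉ A → i′ ∉ A →
  toℕ i < toℕ i′ → color k A i ≢ color k A i′
color-injective-< k A i i′ ∣A∣≡k i∉A i′∉A i<i′ same-color = rotation-≢ u v zeros≡k ones≡k (begin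
    hsteps 0 0 (u ++ false ∷ v)          ≡⟨ cong (hsteps 0 0) word-i ⟨
    hsteps 0 0 (word k A x)              ≡⟨ color≡hsteps-word k A i ⟨
    color k A i                          ≡⟨ same-color ⟩
    color k A i′                         ≡⟨ color≡hsteps-word k A i′ ⟩
    hsteps 0 0 (word k A (toℕ i′))       ≡⟨ cong (λ p → hsteps 0 0 (word k A p)) x′≡ ⟨
    hsteps 0 0 (word k A (suc (x + d)))  ≡⟨ cong (hsteps 0 0) word-i′ ⟩
    hsteps 0 0 (v ++ false ∷ u)          ∎)
  where
    open ≡-Reasoning
    x = toℕ i
    d = toℕ i′ ∸ suc x
    x′≡ : suc (x + d) ≡ toℕ i′
    x′≡ = m+[n∸m]≡n i<i′
    d<2k : suc d ≤ k + k
    d<2k = s≤s⁻¹ (≤-trans (s≤s (s≤s (m≤n+m d x))) (≤-trans (≤-reflexive (cong suc x′≡)) (toℕ<n i′)))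
    r = k + k ∸ suc d
    d+1+r≡2k : d + suc r ≡ k + k
    d+1+r≡2k = trans (+-suc d r) (m+[n∸m]≡n d<2k)
    gap-bit : at k A (suc (x + d)) ≡ false
    gap-bit = trans (cong (at k A) x′≡) (at-outside k A i′ i′∉A)
    rotated = word-rotate k A x d r d+1+r≡2k
    u = proj₁ rotated
    v = proj₁ (proj₂ rotated)
    word-i : word k A x ≡ u ++ false ∷ v
    word-i = trans (proj₁ (proj₂ (proj₂ rotated))) (cong (λ b → u ++ b ∷ v) gap-bit)
    word-i′ : word k A (suc (x + d)) ≡ v ++ false ∷ u
    word-i′ = trans (proj₂ (proj₂ (proj₂ rotated))) (cong (λ b → v ++ b ∷ u) (at-outside k A i i∉A))
    zeros≡k : zeros u + suc (zeros v) ≡ k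
    zeros≡k = trans (sym (zeros-++ u (false ∷ v)))
                (trans (cong zeros (sym word-i)) (word-zeros k A x ∣A∣≡k (at-outside k A i i∉A)))
    ones≡k : ones u + ones v ≡ k
    ones≡k = trans (sym (ones-++ u (false ∷ v)))
               (trans (cong ones (sym word-i)) (trans (word-ones k A x (at-outside k A i i∉A)) ∣A∣≡k))

color-injective : ∀ k A (i i′ : Fin (N k)) → ∣ A ∣ ≡ k → i ∉ A → i′ ∉ A →
  color k A i ≡ color k A i′ → i ≡ i′
color-injective k A i i′ ∣A∣≡k i∉A i′∉A same-color with <-cmp (toℕ i) (toℕ i′)
... | tri< i<i′ _ _ = contradiction same-color (color-injective-< k A i i′ ∣A∣≡k i∉A i′∉A i<i′)
... | tri≈ _ i≡i′ _ = toℕ-injective i≡i′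
... | tri> _ _ i′<i = contradiction (sym same-color) (color-injective-< k A i′ i ∣A∣≡k i′∉A i∉A i′<i)

-- The color as an element of Fin (k + 1), to apply the pigeonhole principle.
colorᶠ : ∀ k → Subset (N k) → Fin (N k) → Fin (suc k)
colorᶠ k A i = color k A i mod suc k

toℕ-colorᶠ : ∀ k A i → ∣ A ∣ ≡ k → i ∉ A → toℕ (colorᶠ k A i) ≡ color k A i
toℕ-colorᶠ k A i ∣A∣≡k i∉A = trans (toℕ-fromℕ< _) (m<n⇒m%n≡m (s≤s (color-≤ k A i ∣A∣≡k i∉A)))

∣∁A∣≡k+1 : ∀ k (A : Subset (N k)) → ∣ A ∣ ≡ k → ∣ ∁ A ∣ ≡ suc k
∣∁A∣≡k+1 k A ∣A∣≡k = trans (∣∁p∣≡n∸∣p∣ A) (trans (cong (N k ∸_) ∣A∣≡k) (m+n∸n≡m (suc k) k))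

-- Part (2) at a k-set A: the k + 1 edges {A, A ∪ {i}} have pairwise distinct
-- colors in {0, …, k}, so each color occurs exactly once.
lower-vertex : ∀ k (A : Subset (N k)) → ∣ A ∣ ≡ k → (j : ℕ) → j ≤ k →
  ∃! _≡_ (λ i → i ∉ A × color k A i ≡ j)
lower-vertex k A ∣A∣≡k j j≤k = i , (i∉A , color≡j) , unique
  where
    colors-differ : ∀ {i i′} → i ∈ ∁ A → i′ ∈ ∁ A → colorᶠ k A i ≡ colorᶠ k A i′ → i ≡ i′
    colors-differ {i} {i′} i∈∁A i′∈∁A eq =
      color-injective k A i i′ ∣A∣≡k (x∈∁p⇒x∉p i∈∁A) (x∈∁p⇒x∉p i′∈∁A)
        (trans (sym (toℕ-colorᶠ k A i ∣A∣≡k (x∈∁p⇒x∉p i∈∁A)))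
          (trans (cong toℕ eq) (toℕ-colorᶠ k A i′ ∣A∣≡k (x∈∁p⇒x∉p i′∈∁A))))
    hit = injection-onto (∁ A) ⊤ (colorᶠ k A) (λ _ → ∈⊤) colors-differ
            (≤-reflexive (trans (∣⊤∣≡n (suc k)) (sym (∣∁A∣≡k+1 k A ∣A∣≡k)))) (∈⊤ {x = fromℕ< (s≤s j≤k)})
    i = proj₁ hit
    i∉A : i ∉ A
    i∉A = x∈∁p⇒x∉p (proj₁ (proj₂ hit))
    color≡j : color k A i ≡ j
    color≡j = trans (sym (toℕ-colorᶠ k A i ∣A∣≡k i∉A)) (trans (cong toℕ (proj₂ (proj₂ hit))) (toℕ-fromℕ< _))
    unique : ∀ {i′} → i′ ∉ A × color k A i′ ≡ j → i ≡ i′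
    unique (i′∉A , color′≡j) = color-injective k A _ _ ∣A∣≡k i∉A i′∉A (trans color≡j (sym color′≡j))

lookup-aleph : ∀ k X (j : Fin (N k)) → lookup (aleph k X) j ≡ not (lookup X (opposite j))
lookup-aleph k X j = lookup∘tabulate (λ j → not (lookup X (opposite j))) j

lookup-aleph-∁ : ∀ k X (j : Fin (N k)) → lookup (aleph k X) j ≡ lookup (∁ X) (opposite j)
lookup-aleph-∁ k X j = trans (lookup-aleph k X j) (sym (lookup-map (opposite j) not X))

opposite-injective : ∀ {m} {a b : Fin m} → opposite a ≡ opposite b → a ≡ b
opposite-injective {a = a} {b} eq = trans (sym (opposite-involutive a)) (trans (cong opposite eq) (opposite-involutive b))

aleph-involutive : ∀ k X → aleph k (aleph k X) ≡ X
aleph-involutive k X = subset-ext λ j → begin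
    lookup (aleph k (aleph k X)) j          ≡⟨ lookup-aleph k (aleph k X) j ⟩
    not (lookup (aleph k X) (opposite j))   ≡⟨ cong not (lookup-aleph k X (opposite j)) ⟩
    not (not (lookup X (opposite (opposite j)))) ≡⟨ not-involutive _ ⟩
    lookup X (opposite (opposite j))        ≡⟨ cong (lookup X) (opposite-involutive j) ⟩
    lookup X j                              ∎
  where open ≡-Reasoning

-- ℵ X and ∁ X are in bijection through opposite, so ∣ ℵ X ∣ = N − ∣ X ∣.
∣aleph∣ : ∀ k X → ∣ aleph k X ∣ ≡ N k ∸ ∣ X ∣
∣aleph∣ k X = trans (≤-antisym (injection-∣≤∣ (aleph k X) (∁ X) opposite into-∁ opposite-inj)
                                (injection-∣≤∣ (∁ X) (aleph k X) opposite into-aleph opposite-inj))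
                    (∣∁p∣≡n∸∣p∣ X)
  where
    opposite-inj : ∀ {S : Subset (N k)} {i j} → i ∈ S → j ∈ S → opposite i ≡ opposite j → i ≡ j
    opposite-inj _ _ = opposite-injective
    into-∁ : ∀ {j} → j ∈ aleph k X → opposite j ∈ ∁ X
    into-∁ {j} = ∈-transport (lookup-aleph-∁ k X j)
    into-aleph : ∀ {j} → j ∈ ∁ X → opposite j ∈ aleph k X
    into-aleph {j} = ∈-transport (sym (trans (lookup-aleph-∁ k X (opposite j)) (cong (lookup (∁ X)) (opposite-involutive j))))

at-aleph : ∀ k X p q → (p + q) % N k ≡ k + k → at k (aleph k X) p ≡ not (at k X q)
at-aleph k X p q sum≡2k = trans (lookup-aleph k X (p mod N k)) (cong (λ j → not (lookup X j)) opposite≡)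
  where
    open ≡-Reasoning
    residue≤2k : ∀ n → n % N k ≤ k + k
    residue≤2k n = s≤s⁻¹ (m%n<n n (N k))
    opposite≡ : opposite (p mod N k) ≡ q mod N k
    opposite≡ = toℕ-injective (begin
      toℕ (opposite (p mod N k))   ≡⟨ opposite-prop (p mod N k) ⟩
      k + k ∸ toℕ (p mod N k)      ≡⟨ cong (k + k ∸_) (toℕ-mod k p) ⟩
      k + k ∸ p % N k              ≡⟨ mod-complement (k + k) (p % N k) (q % N k) (residue≤2k p) (residue≤2k q)
                                        (trans (sym (%-distribˡ-+ p q (N k))) sum≡2k) ⟨
      q % N k                      ≡⟨ toℕ-mod k q ⟨
      toℕ (q mod N k)              ∎)

ℵʷ-applyUpTo : ∀ (h : ℕ → Bool) L → ℵʷ (applyUpTo h L) ≡ applyUpTo (λ t → not (h (L ∸ suc t))) L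
ℵʷ-applyUpTo h zero    = refl
ℵʷ-applyUpTo h (suc L) = begin
    ℵʷ (applyUpTo (λ t → h (suc t)) L) ++ [ not (h 0) ]
      ≡⟨ cong (_++ [ not (h 0) ]) (ℵʷ-applyUpTo (λ t → h (suc t)) L) ⟩
    applyUpTo (λ t → not (h (suc (L ∸ suc t)))) L ∷ʳ not (h 0)
      ≡⟨ cong₂ _∷ʳ_ (applyUpTo-cong L (λ t t<L → cong (λ z → not (h z)) (sym (+-∸-assoc 1 t<L))))
                    (cong (λ z → not (h z)) (sym (n∸n≡0 L))) ⟩
    applyUpTo (λ t → not (h (suc L ∸ suc t))) L ∷ʳ not (h (suc L ∸ suc L))
      ≡⟨ applyUpTo-∷ʳ (λ t → not (h (suc L ∸ suc t))) L ⟩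
    applyUpTo (λ t → not (h (suc L ∸ suc t))) (suc L) ∎
  where open ≡-Reasoning

word-aleph : ∀ k X x y → x + y ≡ k + k → word k (aleph k X) y ≡ ℵʷ (word k X x)
word-aleph k X x y x+y≡2k =
  trans (applyUpTo-cong (k + k) mirrored) (sym (ℵʷ-applyUpTo (λ t → at k X (suc t + x)) (k + k)))
  where
    positions : ∀ t y c x → suc t + y + (suc c + x) ≡ (x + y) + suc (suc t + c)
    positions = solve-∀
    mirrored : ∀ t → t < k + k → at k (aleph k X) (suc t + y) ≡ not (at k X (suc (k + k ∸ suc t) + x))
    mirrored t t<2k = at-aleph k X (suc t + y) (suc (k + k ∸ suc t) + x) (begin
      (suc t + y + (suc (k + k ∸ suc t) + x)) % N k   ≡⟨ cong (_% N k) (positions t y (k + k ∸ suc t) x) ⟩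
      ((x + y) + suc (suc t + (k + k ∸ suc t))) % N k ≡⟨ cong₂ (λ a b → (a + suc b) % N k) x+y≡2k (m+[n∸m]≡n t<2k) ⟩
      (k + k + N k) % N k                             ≡⟨ [m+n]%n≡m%n (k + k) (N k) ⟩
      (k + k) % N k                                   ≡⟨ m<n⇒m%n≡m (n<1+n (k + k)) ⟩
      k + k                                           ∎)
      where open ≡-Reasoning

-- The word at x never reads position x itself.
word-∪-self : ∀ k A (i : Fin (N k)) → word k (A ∪ ⁅ i ⁆) (toℕ i) ≡ word k A (toℕ i)
word-∪-self k A i = applyUpTo-cong (k + k) (λ t t<2k → lookup-∪-other A (position≢i t t<2k))
  where
    position≢i : ∀ t → t < k + k → (suc t + toℕ i) mod N k ≢ i
    position≢i t t<2k eq = rotation-moves k (suc t) (toℕ i) z<s (s≤s t<2k) (toℕ<n i)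
      (trans (sym (toℕ-mod k (suc t + toℕ i))) (cong toℕ eq))

-- Part (3), colors: the edge {ℵ(A ∪ {i}), ℵ A} has the color of {A, A ∪ {i}},
-- because its word is the reflection of a balanced word.
aleph-color : ∀ k (A : Subset (N k)) i → ∣ A ∣ ≡ k → i ∉ A →
  color k (aleph k (A ∪ ⁅ i ⁆)) (opposite i) ≡ color k A i
aleph-color k A i ∣A∣≡k i∉A = begin
    color k (aleph k (A ∪ ⁅ i ⁆)) (opposite i)                 ≡⟨ color≡hsteps-word k (aleph k (A ∪ ⁅ i ⁆)) (opposite i) ⟩
    hsteps 0 0 (word k (aleph k (A ∪ ⁅ i ⁆)) (toℕ (opposite i))) ≡⟨ cong (hsteps 0 0) (word-aleph k (A ∪ ⁅ i ⁆) x (toℕ (opposite i)) x+opposite) ⟩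
    hsteps 0 0 (ℵʷ (word k (A ∪ ⁅ i ⁆) x))                    ≡⟨ cong (λ w → hsteps 0 0 (ℵʷ w)) (word-∪-self k A i) ⟩
    hsteps 0 0 (ℵʷ (word k A x))                               ≡⟨ hsteps-ℵʷ-balanced (word k A x) balanced ⟩
    hsteps 0 0 (word k A x)                                    ≡⟨ color≡hsteps-word k A i ⟨
    color k A i                                                ∎
  where
    open ≡-Reasoning
    x = toℕ i
    x+opposite : x + toℕ (opposite i) ≡ k + k
    x+opposite = trans (cong (x +_) (opposite-prop i)) (m+[n∸m]≡n (s≤s⁻¹ (toℕ<n i)))
    balanced : zeros (word k A x) ≡ ones (word k A x)
    balanced = trans (word-zeros k A x ∣A∣≡k (at-outside k A i i∉A))
                     (sym (trans (word-ones k A x (at-outside k A i i∉A)) ∣A∣≡k))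

aleph-compatible : ∀ k (A : Subset (N k)) i → ∣ A ∣ ≡ k → i ∉ A →
  ∣ aleph k (A ∪ ⁅ i ⁆) ∣ ≡ k
  × opposite i ∉ aleph k (A ∪ ⁅ i ⁆)
  × aleph k A ≡ aleph k (A ∪ ⁅ i ⁆) ∪ ⁅ opposite i ⁆
  × color k (aleph k (A ∪ ⁅ i ⁆)) (opposite i) ≡ color k A i
aleph-compatible k A i ∣A∣≡k i∉A = ∣B∣≡k , opposite-i∉B , aleph-A≡B∪ , aleph-color k A i ∣A∣≡k i∉A
  where
    B = aleph k (A ∪ ⁅ i ⁆)
    ∣B∣≡k : ∣ B ∣ ≡ k
    ∣B∣≡k = trans (∣aleph∣ k (A ∪ ⁅ i ⁆))
              (trans (cong (N k ∸_) (trans (∣∪⁅⁆∣ A i i∉A) (cong suc ∣A∣≡k))) (m+n∸n≡m k k))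
    B-at-opposite-i : lookup B (opposite i) ≡ false
    B-at-opposite-i = trans (lookup-aleph k (A ∪ ⁅ i ⁆) (opposite i))
      (cong not (trans (cong (lookup (A ∪ ⁅ i ⁆)) (opposite-involutive i)) (lookup-∪-self A i)))
    opposite-i∉B : opposite i ∉ B
    opposite-i∉B = outside⇒∉ B (opposite i) B-at-opposite-i
    pointwise : ∀ j → lookup (aleph k A) j ≡ lookup (B ∪ ⁅ opposite i ⁆) j
    pointwise j with j ≟ᶠ opposite i
    ... | yes refl = begin
        lookup (aleph k A) (opposite i)              ≡⟨ lookup-aleph k A (opposite i) ⟩
        not (lookup A (opposite (opposite i)))       ≡⟨ cong (λ j → not (lookup A j)) (opposite-involutive i) ⟩
        not (lookup A i)                             ≡⟨ cong not (∉⇒outside A i i∉A) ⟩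
        true                                         ≡⟨ lookup-∪-self B (opposite i) ⟨
        lookup (B ∪ ⁅ opposite i ⁆) (opposite i)     ∎
      where open ≡-Reasoning
    ... | no j≢opposite-i = begin
        lookup (aleph k A) j                         ≡⟨ lookup-aleph k A j ⟩
        not (lookup A (opposite j))                  ≡⟨ cong not (lookup-∪-other A opposite-j≢i) ⟨
        not (lookup (A ∪ ⁅ i ⁆) (opposite j))        ≡⟨ lookup-aleph k (A ∪ ⁅ i ⁆) j ⟨
        lookup B j                                   ≡⟨ lookup-∪-other B j≢opposite-i ⟨
        lookup (B ∪ ⁅ opposite i ⁆) j                ∎
      where
        open ≡-Reasoning
        opposite-j≢i : opposite j ≢ i
        opposite-j≢i eq = j≢opposite-i (trans (sym (opposite-involutive j)) (cong opposite eq))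
    aleph-A≡B∪ : aleph k A ≡ B ∪ ⁅ opposite i ⁆
    aleph-A≡B∪ = subset-ext pointwise

-- Edges of M_k are encoded as pairs e = (A , i) standing for {A, A ∪ {i}};
-- Edge k j e says that this is an edge of M_k of color j, and top k e = A ∪ {i}.
Edge : ∀ k → ℕ → Subset (N k) × Fin (N k) → Set
Edge k j e = ∣ proj₁ e ∣ ≡ k × proj₂ e ∉ proj₁ e × color k (proj₁ e) (proj₂ e) ≡ j

top : ∀ k → Subset (N k) × Fin (N k) → Subset (N k)
top k e = proj₁ e ∪ ⁅ proj₂ e ⁆

ℵᵉ : ∀ k → Subset (N k) × Fin (N k) → Subset (N k) × Fin (N k)
ℵᵉ k e = aleph k (top k e) , opposite (proj₂ e)

ℵᵉ-edge : ∀ k j e → Edge k j e → Edge k j (ℵᵉ k e)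
ℵᵉ-edge k j (A , i) (∣A∣≡k , i∉A , color≡j) =
  let (∣B∣≡k , opposite-i∉B , _ , same-color) = aleph-compatible k A i ∣A∣≡k i∉A
  in ∣B∣≡k , opposite-i∉B , trans same-color color≡j

top-ℵᵉ : ∀ k j e → Edge k j e → top k (ℵᵉ k e) ≡ aleph k (proj₁ e)
top-ℵᵉ k j (A , i) (∣A∣≡k , i∉A , _) = sym (proj₁ (proj₂ (proj₂ (aleph-compatible k A i ∣A∣≡k i∉A))))

ℵᵉ-involutive : ∀ k j e → Edge k j e → ℵᵉ k (ℵᵉ k e) ≡ e
ℵᵉ-involutive k j (A , i) edge =
  cong₂ _,_ (trans (cong (aleph k) (top-ℵᵉ k j (A , i) edge)) (aleph-involutive k A)) (opposite-involutive i)

-- Part (2) at a (k + 1)-set A′: ℵᵉ is a color-preserving bijection between the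
-- edges below A′ and the edges above the k-set ℵ A′, so lower-vertex applies.
upper-vertex : ∀ k (A′ : Subset (N k)) → ∣ A′ ∣ ≡ suc k → (j : ℕ) → j ≤ k →
  ∃! _≡_ (λ e → top k e ≡ A′ × Edge k j e)
upper-vertex k A′ ∣A′∣≡k+1 j j≤k = ℵᵉ k (B , i) , (top≡A′ , ℵᵉ-edge k j (B , i) edge) , unique
  where
    B = aleph k A′
    ∣B∣≡k : ∣ B ∣ ≡ k
    ∣B∣≡k = trans (∣aleph∣ k A′) (trans (cong (N k ∸_) ∣A′∣≡k+1) (m+n∸n≡m k k))
    lower = lower-vertex k B ∣B∣≡k j j≤k
    i = proj₁ lower
    edge : Edge k j (B , i)
    edge = ∣B∣≡k , proj₁ (proj₂ lower)
    top≡A′ : top k (ℵᵉ k (B , i)) ≡ A′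
    top≡A′ = trans (top-ℵᵉ k j (B , i) edge) (aleph-involutive k A′)
    unique : ∀ {e} → top k e ≡ A′ × Edge k j e → ℵᵉ k (B , i) ≡ e
    unique {e} (top≡A′ , edge′) = begin
        ℵᵉ k (B , i)            ≡⟨ cong (ℵᵉ k) mirror≡ ⟩
        ℵᵉ k (ℵᵉ k e)           ≡⟨ ℵᵉ-involutive k j e edge′ ⟩
        e                       ∎
      where
        open ≡-Reasoning
        mirror : Edge k j (ℵᵉ k e)
        mirror = ℵᵉ-edge k j e edge′
        bottom≡B : aleph k (top k e) ≡ B
        bottom≡B = cong (aleph k) top≡A′
        mirror≡ : (B , i) ≡ ℵᵉ k e
        mirror≡ = cong₂ _,_ (sym bottom≡B)
          (proj₂ (proj₂ lower) (subst (λ X → opposite (proj₂ e) ∉ X × color k X (opposite (proj₂ e)) ≡ j)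
                                       bottom≡B (proj₂ mirror)))

toℕ-addMod² : ∀ k (s t u : Fin (N k)) → toℕ (addMod k (addMod k s t) u) ≡ (toℕ s + toℕ t + toℕ u) % N k
toℕ-addMod² k s t u =
  trans (toℕ-mod k (toℕ (addMod k s t) + toℕ u))
        (trans (cong (λ z → (z + toℕ u) % N k) (toℕ-mod k (toℕ s + toℕ t))) (%-absorbˡ (toℕ s + toℕ t) (toℕ u) (N k)))

neg : ∀ k → Fin (N k) → Fin (N k)
neg k t = (N k ∸ toℕ t) mod N k

neg-cancels : ∀ k a (t : Fin (N k)) → (a + toℕ t + toℕ (neg k t)) % N k ≡ a % N k
neg-cancels k a t = begin
    (a + toℕ t + toℕ (neg k t)) % N k         ≡⟨ cong (λ z → (a + toℕ t + z) % N k) (toℕ-mod k (N k ∸ toℕ t)) ⟩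
    (a + toℕ t + (N k ∸ toℕ t) % N k) % N k   ≡⟨ %-absorbʳ (a + toℕ t) (N k ∸ toℕ t) (N k) ⟩
    (a + toℕ t + (N k ∸ toℕ t)) % N k         ≡⟨ cong (_% N k) (+-assoc a (toℕ t) _) ⟩
    (a + (toℕ t + (N k ∸ toℕ t))) % N k       ≡⟨ cong (λ z → (a + z) % N k) (m+[n∸m]≡n (<⇒≤ (toℕ<n t))) ⟩
    (a + N k) % N k                           ≡⟨ [m+n]%n≡m%n a (N k) ⟩
    a % N k                                   ∎
  where open ≡-Reasoning

sub-add : ∀ k (s t : Fin (N k)) → addMod k (addMod k s (neg k t)) t ≡ s
sub-add k s t = toℕ-mod-injective k (begin
    toℕ (addMod k (addMod k s (neg k t)) t) % N k   ≡⟨ cong (_% N k) (toℕ-addMod² k s (neg k t) t) ⟩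
    (toℕ s + toℕ (neg k t) + toℕ t) % N k % N k     ≡⟨ m%n%n≡m%n (toℕ s + toℕ (neg k t) + toℕ t) (N k) ⟩
    (toℕ s + toℕ (neg k t) + toℕ t) % N k           ≡⟨ cong (_% N k) (swap (toℕ s) _ (toℕ t)) ⟩
    (toℕ s + toℕ t + toℕ (neg k t)) % N k           ≡⟨ neg-cancels k (toℕ s) t ⟩
    toℕ s % N k                                     ∎)
  where
    open ≡-Reasoning
    swap : ∀ a b c → a + b + c ≡ a + c + b
    swap = solve-∀

add-sub : ∀ k (s t : Fin (N k)) → addMod k (addMod k s t) (neg k t) ≡ s
add-sub k s t = toℕ-mod-injective k (trans (cong (_% N k) (toℕ-addMod² k s t (neg k t)))
                 (trans (m%n%n≡m%n (toℕ s + toℕ t + toℕ (neg k t)) (N k)) (neg-cancels k (toℕ s) t)))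

add-zero : ∀ k (s : Fin (N k)) → addMod k s zero ≡ s
add-zero k s = toℕ-mod-injective k (trans (cong (_% N k) (toℕ-mod k (toℕ s + 0)))
                 (trans (m%n%n≡m%n (toℕ s + 0) (N k)) (cong (_% N k) (+-identityʳ (toℕ s)))))

lookup-shift : ∀ k t X (s : Fin (N k)) → lookup (shift k t X) s ≡ lookup X (addMod k s t)
lookup-shift k t X s = lookup∘tabulate (λ s → lookup X (addMod k s t)) s

shift-zero : ∀ k (A : Subset (N k)) → shift k zero A ≡ A
shift-zero k A = subset-ext (λ s → trans (lookup-shift k zero A s) (cong (lookup A) (add-zero k s)))

shift-neg : ∀ k t (B : Subset (N k)) → shift k (neg k t) (shift k t B) ≡ B
shift-neg k t B = subset-ext λ s →
  trans (lookup-shift k (neg k t) (shift k t B) s) (trans (lookup-shift k t B (addMod k s (neg k t))) (cong (lookup B) (sub-add k s t)))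

∣shift∣ : ∀ k t (B : Subset (N k)) → ∣ shift k t B ∣ ≡ ∣ B ∣
∣shift∣ k t B = ≤-antisym
  (injection-∣≤∣ (shift k t B) B (λ s → addMod k s t)
    (λ {s} → ∈-transport (lookup-shift k t B s))
    (λ {s} {s′} _ _ eq → trans (sym (add-sub k s t)) (trans (cong (λ z → addMod k z (neg k t)) eq) (add-sub k s′ t))))
  (injection-∣≤∣ B (shift k t B) (λ b → addMod k b (neg k t))
    (λ {b} → ∈-transport (sym (trans (lookup-shift k t B (addMod k b (neg k t))) (cong (lookup B) (sub-add k b t)))))
    (λ {b} {b′} _ _ eq → trans (sym (sub-add k b t)) (trans (cong (λ z → addMod k z t) eq) (sub-add k b′ t))))

-- Part (0): the lexical color is invariant under translation, since the word
-- only depends on the positions relative to the added element.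
color-shift : ∀ k A i t → color k (shift k t A) i ≡ color k A (addMod k i t)
color-shift k A i t = begin
    color k (shift k t A) i                          ≡⟨ color≡hsteps-word k (shift k t A) i ⟩
    hsteps 0 0 (word k (shift k t A) (toℕ i))        ≡⟨ cong (hsteps 0 0) (applyUpTo-cong (k + k) shifted) ⟩
    hsteps 0 0 (word k A (toℕ (addMod k i t)))       ≡⟨ color≡hsteps-word k A (addMod k i t) ⟨
    color k A (addMod k i t)                         ∎
  where
    open ≡-Reasoning
    x = toℕ i
    shifted : ∀ u → u < k + k → at k (shift k t A) (suc u + x) ≡ at k A (suc u + toℕ (addMod k i t))
    shifted u _ = trans (lookup-shift k t A ((suc u + x) mod N k))
                        (at-cong k A (toℕ ((suc u + x) mod N k) + toℕ t) (suc u + toℕ (addMod k i t)) (begin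
      (toℕ ((suc u + x) mod N k) + toℕ t) % N k   ≡⟨ cong (λ z → (z + toℕ t) % N k) (toℕ-mod k (suc u + x)) ⟩
      ((suc u + x) % N k + toℕ t) % N k           ≡⟨ %-absorbˡ (suc u + x) (toℕ t) (N k) ⟩
      (suc u + x + toℕ t) % N k                   ≡⟨ cong (_% N k) (+-assoc (suc u) x (toℕ t)) ⟩
      (suc u + (x + toℕ t)) % N k                 ≡⟨ %-absorbʳ (suc u) (x + toℕ t) (N k) ⟨
      (suc u + (x + toℕ t) % N k) % N k           ≡⟨ cong (λ z → (suc u + z) % N k) (toℕ-mod k (x + toℕ t)) ⟨
      (suc u + toℕ (addMod k i t)) % N k          ∎))

translate : ∀ k → Fin (N k) → Subset (N k) × Fin (N k) → Subset (N k) × Fin (N k)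
translate k t e = shift k t (proj₁ e) , addMod k (proj₂ e) (neg k t)

translate-edge : ∀ k j t e → Edge k j e → Edge k j (translate k t e)
translate-edge k j t (B , i) (∣B∣≡k , i∉B , color≡j) =
    trans (∣shift∣ k t B) ∣B∣≡k
  , outside⇒∉ (shift k t B) i′ (trans (lookup-shift k t B i′) (trans (cong (lookup B) (sub-add k i t)) (∉⇒outside B i i∉B)))
  , trans (color-shift k B i′ t) (trans (cong (color k B) (sub-add k i t)) color≡j)
  where i′ = addMod k i (neg k t)

top-translate : ∀ k t e → top k (translate k t e) ≡ shift k t (top k e)
top-translate k t (B , i) = subset-ext pointwise
  where
    i′ = addMod k i (neg k t)
    pointwise : ∀ s → lookup (shift k t B ∪ ⁅ i′ ⁆) s ≡ lookup (shift k t (B ∪ ⁅ i ⁆)) s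
    pointwise s with s ≟ᶠ i′
    ... | yes refl = begin
        lookup (shift k t B ∪ ⁅ i′ ⁆) i′     ≡⟨ lookup-∪-self (shift k t B) i′ ⟩
        true                                 ≡⟨ lookup-∪-self B i ⟨
        lookup (B ∪ ⁅ i ⁆) i                 ≡⟨ cong (lookup (B ∪ ⁅ i ⁆)) (sub-add k i t) ⟨
        lookup (B ∪ ⁅ i ⁆) (addMod k i′ t)   ≡⟨ lookup-shift k t (B ∪ ⁅ i ⁆) i′ ⟨
        lookup (shift k t (B ∪ ⁅ i ⁆)) i′    ∎
      where open ≡-Reasoning
    ... | no s≢i′ = begin
        lookup (shift k t B ∪ ⁅ i′ ⁆) s      ≡⟨ lookup-∪-other (shift k t B) s≢i′ ⟩
        lookup (shift k t B) s               ≡⟨ lookup-shift k t B s ⟩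
        lookup B (addMod k s t)              ≡⟨ lookup-∪-other B s+t≢i ⟨
        lookup (B ∪ ⁅ i ⁆) (addMod k s t)    ≡⟨ lookup-shift k t (B ∪ ⁅ i ⁆) s ⟨
        lookup (shift k t (B ∪ ⁅ i ⁆)) s     ∎
      where
        open ≡-Reasoning
        s+t≢i : addMod k s t ≢ i
        s+t≢i eq = s≢i′ (trans (sym (add-sub k s t)) (cong (λ z → addMod k z (neg k t)) eq))

orbit-unique : ∀ k j (end : Subset (N k) × Fin (N k) → Subset (N k)) (V : Subset (N k)) →
  (∀ t e → end (translate k t e) ≡ shift k t (end e)) →
  ∃! _≡_ (λ e → end e ≡ V × Edge k j e) →
  ∃! (translE k) (λ e → transl k (end e) V × Edge k j e)
orbit-unique k j end V end-translate (e₀ , (end≡V , edge₀) , unique₀) =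
  e₀ , ((zero , trans (sym end≡V) (sym (shift-zero k (end e₀)))) , edge₀) , unique
  where
    unique : ∀ {e} → transl k (end e) V × Edge k j e → translE k e₀ e
    unique {e} ((t , V≡) , edge) = neg k t , B≡ , i≡
      where
        e₀≡ : e₀ ≡ translate k t e
        e₀≡ = unique₀ (trans (end-translate t e) (sym V≡) , translate-edge k j t e edge)
        B≡ : proj₁ e ≡ shift k (neg k t) (proj₁ e₀)
        B≡ = trans (sym (shift-neg k t (proj₁ e))) (cong (λ X → shift k (neg k t) (proj₁ X)) (sym e₀≡))
        i≡ : addMod k (proj₂ e) (neg k t) ≡ proj₂ e₀
        i≡ = sym (cong proj₂ e₀≡)

lower-edge : ∀ k (A : Subset (N k)) → ∣ A ∣ ≡ k → (j : ℕ) → j ≤ k →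
  ∃! _≡_ (λ e → proj₁ e ≡ A × Edge k j e)
lower-edge k A ∣A∣≡k j j≤k = (A , i) , (refl , ∣A∣≡k , proj₁ (proj₂ lower)) , unique
  where
    lower = lower-vertex k A ∣A∣≡k j j≤k
    i = proj₁ lower
    unique : ∀ {e} → proj₁ e ≡ A × Edge k j e → (A , i) ≡ e
    unique {B , i′} (refl , _ , i′∉A , color≡j) = cong (A ,_) (proj₂ (proj₂ lower) (i′∉A , color≡j))

theorem2 : (k : ℕ) → 1 ≤ k →
  -- (0) colors lie in {0..k} and are translation invariant
  ((A : Subset (N k)) (i : Fin (N k)) → ∣ A ∣ ≡ k → i ∉ A → color k A i ≤ k)
  × ((A : Subset (N k)) (i t : Fin (N k)) → ∣ A ∣ ≡ k → addMod k i t ∉ A →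
      color k (shift k t A) i ≡ color k A (addMod k i t))
  -- (1) in M_k/π every vertex meets exactly one edge orbit of each color j ≤ k
  × ((A : Subset (N k)) → ∣ A ∣ ≡ k → (j : ℕ) → j ≤ k →
      ∃! (translE k) (λ e → transl k (proj₁ e) A × ∣ proj₁ e ∣ ≡ k × proj₂ e ∉ proj₁ e
                      × color k (proj₁ e) (proj₂ e) ≡ j))
  × ((A′ : Subset (N k)) → ∣ A′ ∣ ≡ suc k → (j : ℕ) → j ≤ k →
      ∃! (translE k) (λ e → transl k (proj₁ e ∪ ⁅ proj₂ e ⁆) A′ × ∣ proj₁ e ∣ ≡ k × proj₂ e ∉ proj₁ e
                      × color k (proj₁ e) (proj₂ e) ≡ j))
  -- (2) in M_k every vertex meets exactly one edge of each color j ≤ k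
  × ((A : Subset (N k)) → ∣ A ∣ ≡ k → (j : ℕ) → j ≤ k →
      ∃! _≡_ (λ i → i ∉ A × color k A i ≡ j))
  × ((A′ : Subset (N k)) → ∣ A′ ∣ ≡ suc k → (j : ℕ) → j ≤ k →
      ∃! _≡_ (λ e → (proj₁ e ∪ ⁅ proj₂ e ⁆) ≡ A′ × ∣ proj₁ e ∣ ≡ k × proj₂ e ∉ proj₁ e
                      × color k (proj₁ e) (proj₂ e) ≡ j))
  -- (3) compatibility with aleph
  × ((A : Subset (N k)) (i : Fin (N k)) → ∣ A ∣ ≡ k → i ∉ A →
      ∣ aleph k (A ∪ ⁅ i ⁆) ∣ ≡ k
      × opposite i ∉ aleph k (A ∪ ⁅ i ⁆)
      × aleph k A ≡ aleph k (A ∪ ⁅ i ⁆) ∪ ⁅ opposite i ⁆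
      × color k (aleph k (A ∪ ⁅ i ⁆)) (opposite i) ≡ color k A i)
theorem2 k _ =
    color-≤ k
  , (λ A i t _ _ → color-shift k A i t)
  , (λ A ∣A∣≡k j j≤k → orbit-unique k j proj₁ A (λ _ _ → refl) (lower-edge k A ∣A∣≡k j j≤k))
  , (λ A′ ∣A′∣≡k+1 j j≤k → orbit-unique k j (top k) A′ (top-translate k) (upper-vertex k A′ ∣A′∣≡k+1 j j≤k))
  , lower-vertex k
  , upper-vertex k
  , aleph-compatible k
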